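{- Let $k$ be an odd positive integer and let $A$ be a group isomorphic either to $C_k$ or to $C_k \times C_3$. Let $R = A \rtimes \langle r\rangle$, where $r$ has order $8$ and $r^{ -1}ar = a^{ -1}$ for every $a \in A$. Then $R$ does not have the DCI property.
   Context: For a group $G$ and a subset $S \subseteq G$, the Cayley digraph $\mathrm{Cay}(G,S)$ has vertex set $G$ and an arc from $g$ to $sg$ for every $g\in G$, $s \in S$. A Cayley digraph $\mathrm{Cay}(G,S)$ has the DCI (Directed Cayley Isomorphism) property if for every $T \subseteq G$ with $\mathrm{Cay}(G,T) \cong \mathrm{Cay}(G,S)$ there is an automorphism $\alpha \in \mathrm{Aut}(G)$ with $S^\alpha = T$. A group $G$ has the DCI property if every Cayley digraph on $G$ has the DCI property. $C_m$ denotes the cyclic group of order $m$. -}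

module Defs where

open import Data.Nat using (ℕ; _+_; _∸_; NonZero)
open import Data.Nat.DivMod using (_mod_)
open import Data.Fin using (Fin; toℕ)
open import Data.Bool using (Bool; true)
open import Data.Product using (Σ; _×_; _,_; ∃)
open import Relation.Binary.PropositionalEquality using (_≡_)
open import Function.Bundles using (_↔_; Inverse)
open import Relation.Nullary using (¬_)

Subset : Set → Set
Subset G = G → Bool

module _ {G : Set} (_∙_ : G → G → G) where

  Arc : Subset G → G → G → Set
  Arc S g h = Σ G λ s → (S s ≡ true) × (h ≡ s ∙ g)

  CayIso : Subset G → Subset G → Set
  CayIso S T = Σ (G ↔ G) λ φ →
    ∀ g h → (Arc S g h → Arc T (Inverse.to φ g) (Inverse.to φ h))
          × (Arc T (Inverse.to φ g) (Inverse.to φ h) → Arc S g h)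

  IsAut : (G ↔ G) → Set
  IsAut α = ∀ x y → Inverse.to α (x ∙ y) ≡ Inverse.to α x ∙ Inverse.to α y

  MapsTo : (G ↔ G) → Subset G → Subset G → Set
  MapsTo α S T = ∀ y → (T y ≡ true → ∃ λ x → (S x ≡ true) × (Inverse.to α x ≡ y))
                     × (∀ x → S x ≡ true → Inverse.to α x ≡ y → T y ≡ true)

  CayDCI : Subset G → Set
  CayDCI S = ∀ T → CayIso S T → Σ (G ↔ G) λ α → IsAut α × MapsTo α S T

  HasDCI : Set
  HasDCI = ∀ S → CayDCI S

module Cyclic (n : ℕ) .{{_ : NonZero n}} where
  _⊕_ : Fin n → Fin n → Fin n
  a ⊕ b = (toℕ a + toℕ b) mod n

  ⊖_ : Fin n → Fin n
  ⊖ a = (n ∸ toℕ a) mod n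

open Cyclic using (_⊕_; ⊖_)

-- Semidirect product A ⋊ ⟨r⟩ with r of order 8 acting by inversion.
-- Element (a , i) stands for a r^i; since r^{-1} a r = a^{-1} we get
-- (a r^i)(b r^j) = (a + (-1)^i b) r^(i+j).

sgnAct : {A : Set} → (A → A) → Fin 8 → A → A
sgnAct neg i b with toℕ i mod 2
... | Fin.zero = b
... | Fin.suc _ = neg b

Semidirect : (A : Set) → (A → A → A) → (A → A) →
             (A × Fin 8) → (A × Fin 8) → (A × Fin 8)
Semidirect A _+A_ negA (a , i) (b , j) =
  (a +A sgnAct negA i b) , _⊕_ 8 i j

R₁-carrier : ℕ → Set
R₁-carrier k = Fin k × Fin 8

R₁-mul : (k : ℕ) .{{_ : NonZero k}} → R₁-carrier k → R₁-carrier k → R₁-carrier k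
R₁-mul k = Semidirect (Fin k) (_⊕_ k) (⊖_ k)

C₃k : ℕ → Set
C₃k k = Fin k × Fin 3

addC₃k : (k : ℕ) .{{_ : NonZero k}} → C₃k k → C₃k k → C₃k k
addC₃k k (a , x) (b , y) = _⊕_ k a b , _⊕_ 3 x y

negC₃k : (k : ℕ) .{{_ : NonZero k}} → C₃k k → C₃k k
negC₃k k (a , x) = ⊖_ k a , ⊖_ 3 x

R₂-carrier : ℕ → Set
R₂-carrier k = C₃k k × Fin 8

R₂-mul : (k : ℕ) .{{_ : NonZero k}} → R₂-carrier k → R₂-carrier k → R₂-carrier k
R₂-mul k = Semidirect (C₃k k) (addC₃k k) (negC₃k k)

{-# OPTIONS --safe #-}
module Submission where

open import Defs
open import Data.Bool using (true; false; _∧_)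
open import Data.Bool.Properties using (∧-zeroʳ) renaming (_≟_ to _≟ᵇ_)
open import Data.Fin using (Fin; toℕ; zero)
open import Data.Fin.Patterns using (0F; 1F; 2F; 3F; 5F; 6F; 7F)
open import Data.Fin.Permutation
  using (Permutation′; transpose; _∘ₚ_; _⟨$⟩ʳ_; _⟨$⟩ˡ_; inverseˡ; inverseʳ)
open import Data.Fin.Properties using (all?; any?; toℕ-injective; toℕ-fromℕ<) renaming (_≟_ to _≟ᶠ_)
open import Data.Nat using (ℕ; NonZero; _%_; suc)
open import Data.Nat.DivMod using (_mod_; n%n≡0)
open import Data.Product using (_×_; _,_; ∃; proj₂; map₂)
open import Data.Product.Properties using (≡-dec)
open import Function.Base using (case_of_)
open import Function.Bundles using (_↔_; Inverse; mk↔ₛ′)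
open import Relation.Binary.Definitions using (DecidableEquality)
open import Relation.Binary.PropositionalEquality
  using (_≡_; refl; sym; trans; cong; cong₂; subst₂; module ≡-Reasoning)
open import Relation.Nullary using (¬_; Dec; does; yes)
open import Relation.Nullary.Decidable using (dec-true; from-yes; _×-dec_; _→-dec_)

open Cyclic using (_⊕_; ⊖_)

-- Connection sets S ⊆ ⟨r⟩ ≅ C₈ make Cay(R, S) a disjoint union of copies of
-- Cay(C₈, S), so a witness that C₈ is not DCI, S = {r, r², r⁵} and T = {r, r⁵, r⁶}, lifts:
-- the permutation of C₈ swapping 2 ↔ 6 and 3 ↔ 7 is an isomorphism Cay(C₈, S) ≅ Cay(C₈, T)
-- that preserves the parity of arc labels, hence is compatible with r acting on A by
-- inversion, and applied to the ⟨r⟩-coordinate it gives Cay(R, S) ≅ Cay(R, T). No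
-- automorphism maps S to T, because S contains r and r² while no element of T has its
-- square in T. The argument never looks at A.

module _ {G : Set} (_∙_ : G → G → G) where

  ContainsSquare : Subset G → Set
  ContainsSquare S = ∃ λ x → S x ≡ true × S (x ∙ x) ≡ true

  SquareFree : Subset G → Set
  SquareFree T = ∀ y → T y ≡ true → T (y ∙ y) ≡ false

  ¬CayDCI-squares : ∀ {S T} → CayIso _∙_ S T → ContainsSquare S → SquareFree T →
                    ¬ CayDCI _∙_ S
  ¬CayDCI-squares {S} {T} iso (x , Sx , Sxx) T-squareFree dci
    with α , α-hom , α-maps ← dci T iso = case true≡false of λ ()
    where
    open ≡-Reasoning
    f = Inverse.to α
    image : ∀ {y} → S y ≡ true → T (f y) ≡ true
    image Sy = proj₂ (α-maps _) _ Sy refl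
    true≡false : true ≡ false
    true≡false = begin
      true           ≡⟨ sym (image Sxx) ⟩
      T (f (x ∙ x))  ≡⟨ cong T (α-hom x x) ⟩
      T (f x ∙ f x)  ≡⟨ T-squareFree (f x) (image Sx) ⟩
      false          ∎

C₈ : Set
C₈ = Fin 8

_+₈_ : C₈ → C₈ → C₈
_+₈_ = _⊕_ 8

parity : C₈ → Fin 2
parity i = toℕ i mod 2

sgnAct-cong : ∀ {A : Set} (neg : A → A) {i i′} → parity i ≡ parity i′ →
              ∀ b → sgnAct neg i b ≡ sgnAct neg i′ b
sgnAct-cong neg {i} {i′} same b with toℕ i mod 2 | toℕ i′ mod 2 | same
... | 0F | 0F | refl = refl
... | 1F | 1F | refl = refl

sgnAct-fixes : ∀ {A : Set} (neg : A → A) {z} → neg z ≡ z → ∀ i → sgnAct neg i z ≡ z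
sgnAct-fixes neg neg-z i with toℕ i mod 2
... | 0F = refl
... | 1F = neg-z

-- Parity matters because left multiplication by r^i acts on the A-coordinate by (-1)^i.
ParityArcMap : (C₈ → C₈) → Subset C₈ → Subset C₈ → Set
ParityArcMap φ X Y = ∀ i j → X i ≡ true →
  ∃ λ i′ → Y i′ ≡ true × φ (i +₈ j) ≡ i′ +₈ φ j × parity i ≡ parity i′

parityArcMap? : ∀ φ X Y → Dec (ParityArcMap φ X Y)
parityArcMap? φ X Y = all? λ i → all? λ j → X i ≟ᵇ true →-dec any? λ i′ →
  (Y i′ ≟ᵇ true) ×-dec (φ (i +₈ j) ≟ᶠ i′ +₈ φ j) ×-dec (parity i ≟ᶠ parity i′)

squareFree₈? : ∀ Y → Dec (SquareFree _+₈_ Y)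
squareFree₈? Y = all? λ y → Y y ≟ᵇ true →-dec Y (y +₈ y) ≟ᵇ false

S₈ T₈ : Subset C₈
S₈ 1F = true
S₈ 2F = true
S₈ 5F = true
S₈ _  = false
T₈ 1F = true
T₈ 5F = true
T₈ 6F = true
T₈ _  = false

π₈ : Permutation′ 8
π₈ = transpose 2F 6F ∘ₚ transpose 3F 7F

π₈-S₈→T₈ : ParityArcMap (π₈ ⟨$⟩ʳ_) S₈ T₈
π₈-S₈→T₈ = from-yes (parityArcMap? (π₈ ⟨$⟩ʳ_) S₈ T₈)

π₈⁻¹-T₈→S₈ : ParityArcMap (π₈ ⟨$⟩ˡ_) T₈ S₈
π₈⁻¹-T₈→S₈ = from-yes (parityArcMap? (π₈ ⟨$⟩ˡ_) T₈ S₈)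

S₈-containsSquare : ContainsSquare _+₈_ S₈
S₈-containsSquare = 1F , refl , refl

T₈-squareFree : SquareFree _+₈_ T₈
T₈-squareFree = from-yes (squareFree₈? T₈)

module SemidirectC₈ {A : Set} (_+_ : A → A → A) (-_ : A → A) (0# : A)
                    (_≟_ : DecidableEquality A) where

  _∙_ : A × C₈ → A × C₈ → A × C₈
  _∙_ = Semidirect A _+_ -_

  rPowers : Subset C₈ → Subset (A × C₈)
  rPowers X (a , i) = does (a ≟ 0#) ∧ X i

  rPowers⁺ : ∀ X {a i} → a ≡ 0# → X i ≡ true → rPowers X (a , i) ≡ true
  rPowers⁺ X {a} a≡0 Xi rewrite dec-true (a ≟ 0#) a≡0 = Xi

  rPowers⁻ : ∀ X {a i} → rPowers X (a , i) ≡ true → a ≡ 0# × X i ≡ true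
  rPowers⁻ X {a} Xi with a ≟ 0#
  ... | yes a≡0 = a≡0 , Xi

  rPowers-arcs : ∀ {φ X Y} → ParityArcMap φ X Y →
    ∀ {g h} → Arc _∙_ (rPowers X) g h → Arc _∙_ (rPowers Y) (map₂ φ g) (map₂ φ h)
  rPowers-arcs {X = X} {Y} φ-arcs {a , j} ((b , i) , s∈X , refl)
    with refl , Xi ← rPowers⁻ X s∈X
    with i′ , Yi′ , φ-shift , same-parity ← φ-arcs i j Xi
    = (0# , i′) , rPowers⁺ Y refl Yi′ ,
      cong₂ _,_ (cong (0# +_) (sgnAct-cong -_ {i} {i′} same-parity a)) φ-shift

  liftPermutation : Permutation′ 8 → (A × C₈) ↔ (A × C₈)
  liftPermutation π = mk↔ₛ′ (map₂ (π ⟨$⟩ʳ_)) (map₂ (π ⟨$⟩ˡ_))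
    (λ (a , i) → cong (a ,_) (inverseʳ π)) (λ (a , i) → cong (a ,_) (inverseˡ π))

  rPowers-cayIso : ∀ {X Y} (π : Permutation′ 8) →
    ParityArcMap (π ⟨$⟩ʳ_) X Y → ParityArcMap (π ⟨$⟩ˡ_) Y X → CayIso _∙_ (rPowers X) (rPowers Y)
  rPowers-cayIso {X} π π-arcs π⁻¹-arcs = liftPermutation π , λ g h →
    rPowers-arcs π-arcs ,
    λ arc → subst₂ (Arc _∙_ (rPowers X)) (back g) (back h) (rPowers-arcs π⁻¹-arcs arc)
    where
    back : ∀ g → map₂ (π ⟨$⟩ˡ_) (map₂ (π ⟨$⟩ʳ_) g) ≡ g
    back (a , i) = cong (a ,_) (inverseˡ π)

  rPowers-squareFree : ∀ {Y} → SquareFree _+₈_ Y → SquareFree _∙_ (rPowers Y)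
  rPowers-squareFree {Y} Y-squareFree (a , u) y∈Y
    rewrite Y-squareFree u (proj₂ (rPowers⁻ Y y∈Y)) = ∧-zeroʳ _

  rPowers-containsSquare : 0# + 0# ≡ 0# → - 0# ≡ 0# →
    ∀ {X} → ContainsSquare _+₈_ X → ContainsSquare _∙_ (rPowers X)
  rPowers-containsSquare 0#+0#≡0# -0#≡0# {X} (u , Xu , Xuu) =
    (0# , u) , rPowers⁺ X refl Xu ,
    rPowers⁺ X (trans (cong (0# +_) (sgnAct-fixes -_ -0#≡0# u)) 0#+0#≡0#) Xuu

  ¬HasDCI : 0# + 0# ≡ 0# → - 0# ≡ 0# → ¬ HasDCI _∙_
  ¬HasDCI 0#+0#≡0# -0#≡0# dci =
    ¬CayDCI-squares _∙_ (rPowers-cayIso π₈ π₈-S₈→T₈ π₈⁻¹-T₈→S₈)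
      (rPowers-containsSquare 0#+0#≡0# -0#≡0# S₈-containsSquare)
      (rPowers-squareFree T₈-squareFree)
      (dci (rPowers S₈))

⊖-zero : ∀ m → ⊖_ (suc m) zero ≡ zero
⊖-zero m = toℕ-injective (trans (toℕ-fromℕ< _) (n%n≡0 (suc m)))

theorem1p1 : (k : ℕ) .{{_ : NonZero k}} → k % 2 ≡ 1 →
    (¬ HasDCI (R₁-mul k)) × (¬ HasDCI (R₂-mul k))
theorem1p1 (suc m) _ =
  SemidirectC₈.¬HasDCI (_⊕_ k) (⊖_ k) zero _≟ᶠ_ refl (⊖-zero m) ,
  SemidirectC₈.¬HasDCI (addC₃k k) (negC₃k k) (zero , zero) (≡-dec _≟ᶠ_ _≟ᶠ_)
    refl (cong₂ _,_ (⊖-zero m) (⊖-zero 2))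
  where k = suc m
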